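{- Let $G$ be a finite, simple, connected $2K_2$-free graph. If there exists $k \in \{3,4,5\}$ such that $G$ has no induced cycle of length $k$, then $c(G) \leq 2$.
   Context: $2K_2$ denotes the graph consisting of two disjoint edges (the complement of the 4-cycle). A graph $G$ is $H$-free if it contains no induced subgraph isomorphic to $H$. The game of cops and robbers on $G$: $k$ cops each choose a starting vertex, then a single robber chooses a vertex; then players alternate turns starting with the cops. On the cops' turn each cop stays put or moves to an adjacent vertex; on the robber's turn he stays put or moves to an adjacent vertex. All moves are visible to both sides. The cops win if at some point a cop occupies the robber's vertex. The cop number $c(G)$ is the minimum number of cops for which the cops have a winning strategy on $G$. -}

module Defs where

open import Data.Nat using (ℕ; suc; _%_)
open import Data.Fin using (Fin; toℕ)
open import Data.Bool using (Bool; true; false)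
open import Data.Vec using (Vec)
open import Data.Vec.Membership.Propositional using (_∈_)
open import Data.Vec.Relation.Binary.Pointwise.Inductive using (Pointwise)
open import Data.Product using (Σ; _×_; ∃; ∃-syntax)
open import Data.Sum using (_⊎_)
open import Relation.Binary.PropositionalEquality using (_≡_)
open import Relation.Nullary using (¬_)
open import Function.Definitions using (Injective)

record Graph (n : ℕ) : Set where
  field
    adj   : Fin n → Fin n → Bool
    irrefl : ∀ v → adj v v ≡ false
    sym   : ∀ u v → adj u v ≡ adj v u
open Graph public

Adj : ∀ {n} → Graph n → Fin n → Fin n → Set
Adj G u v = adj G u v ≡ true

data Reach {n} (G : Graph n) : Fin n → Fin n → Set where
  here  : ∀ {v} → Reach G v v
  step  : ∀ {u w v} → Adj G u w → Reach G w v → Reach G u v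

Connected : ∀ {n} → Graph n → Set
Connected G = ∀ u v → Reach G u v

-- G contains an induced subgraph isomorphic to 2K₂: vertices a,b,c,d with
-- edges ab and cd and no other edges among them (distinctness is implied,
-- but stated anyway).
Has2K2 : ∀ {n} → Graph n → Set
Has2K2 {n} G = Σ (Fin n) λ a → Σ (Fin n) λ b → Σ (Fin n) λ c → Σ (Fin n) λ d →
  (¬ a ≡ b) × (¬ a ≡ c) × (¬ a ≡ d) × (¬ b ≡ c) × (¬ b ≡ d) × (¬ c ≡ d) ×
  Adj G a b × Adj G c d ×
  adj G a c ≡ false × adj G a d ≡ false × adj G b c ≡ false × adj G b d ≡ false

Free2K2 : ∀ {n} → Graph n → Set
Free2K2 G = ¬ Has2K2 G

CycAdj : (k : ℕ) → Fin k → Fin k → Set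
CycAdj (suc k') i j = (suc (toℕ i) % suc k' ≡ toℕ j) ⊎ (suc (toℕ j) % suc k' ≡ toℕ i)
CycAdj _ _ _ = Data.Empty.⊥
  where import Data.Empty

HasInducedCycle : ∀ {n} → Graph n → ℕ → Set
HasInducedCycle {n} G k = Σ (Fin k → Fin n) λ f → Injective _≡_ _≡_ f ×
  (∀ i j → (Adj G (f i) (f j) → CycAdj k i j) × (CycAdj k i j → Adj G (f i) (f j)))

Move : ∀ {n} → Graph n → Fin n → Fin n → Set
Move G u v = u ≡ v ⊎ Adj G u v

CopsMove : ∀ {n k} → Graph n → Vec (Fin n) k → Vec (Fin n) k → Set
CopsMove G = Pointwise (Move G)

-- CopWin G cs r : cops at positions cs, robber at r, cops to move;
-- the cops can force capture in finitely many rounds (inductive attractor).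
data CopWin {n k} (G : Graph n) : Vec (Fin n) k → Fin n → Set where
  win : ∀ {cs r} → (cs' : Vec (Fin n) k) → CopsMove G cs cs' →
        (r ∈ cs' ⊎ (∀ r' → Move G r r' → r' ∈ cs' ⊎ CopWin G cs' r')) →
        CopWin G cs r

-- k cops have a winning strategy: they choose starting positions, then the
-- robber chooses his; he is caught immediately or the cops (to move) win.
CopsWin : ∀ {n} → Graph n → ℕ → Set
CopsWin {n} G k = Σ (Vec (Fin n) k) λ cs → ∀ r → r ∈ cs ⊎ CopWin G cs r

CopNumber≤ : ∀ {n} → Graph n → ℕ → Set
CopNumber≤ G m = ∃[ k ] (k Data.Nat.≤ m × CopsWin G k)
  where import Data.Nat

module Submission where

-- The cops start on an edge ab.  If the robber r is not next to
-- them, 2K₂-freeness applied to ab and an edge ry forces a cop onto a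
-- neighbour y of r.  The cops then walk along the robber's trail, always
-- occupying an edge whose far end is adjacent to the robber's previous
-- position.  Each robber move that stays out of reach extends an induced
-- path y r r₁ r₂, and after one more move 2K₂-freeness closes it into an
-- induced pentagon y r r₁ r₂ r₃.  If G has no induced C₅ this is already
-- absurd.  Otherwise the cops advance once more; any safe robber square s
-- is adjacent to r₃ and to r or r₁, which creates an induced C₄ — and, if
-- instead G is triangle-free, one further round leaves the robber without
-- a safe square at all (every candidate yields a 2K₂ or a triangle).

open import Defs renaming (sym to adj-sym)
open import Data.Nat using (ℕ; zero; suc; z≤n)
import Data.Nat as ℕ
open import Data.Nat.DivMod using (_mod_)
open import Data.Nat.Properties using (≤-refl)
open import Data.Fin using (Fin; toℕ; zero; suc)
open import Data.Fin.Properties using (toℕ-injective; toℕ-fromℕ<; all?; any?)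
  renaming (_≟_ to _≟ᶠ_)
open import Data.Bool using (true; false)
import Data.Bool as Bool
open import Data.Bool.Properties using (¬-not)
open import Data.Vec using ([]; _∷_; lookup)
open import Data.Vec.Membership.Propositional using (_∈_)
open import Data.Vec.Relation.Unary.Any using (here; there)
open import Data.Vec.Relation.Binary.Pointwise.Inductive using ([]; _∷_)
open import Data.Product using (Σ; _×_; _,_)
open import Data.Sum using (_⊎_; inj₁; inj₂)
open import Data.Empty using (⊥; ⊥-elim)
open import Relation.Binary.PropositionalEquality
  using (_≡_; _≢_; refl; sym; trans; subst; ≢-sym)
open import Relation.Nullary using (¬_; Dec; yes; no)
open import Relation.Nullary.Decidable using (toWitness; _⊎-dec_; _→-dec_; ¬?)

pattern 0F = zero
pattern 1F = suc zero
pattern 2F = suc (suc zero)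
pattern 3F = suc (suc (suc zero))
pattern 4F = suc (suc (suc (suc zero)))

next : ∀ {k} → Fin (suc k) → Fin (suc k)
next {k} i = suc (toℕ i) mod suc k

adjacent⇒next : ∀ {k} {i j : Fin (suc k)} →
  CycAdj (suc k) i j → j ≡ next i ⊎ i ≡ next j
adjacent⇒next (inj₁ p) = inj₁ (toℕ-injective (trans (sym p) (sym (toℕ-fromℕ< _))))
adjacent⇒next (inj₂ p) = inj₂ (toℕ-injective (trans (sym p) (sym (toℕ-fromℕ< _))))

cycAdj? : ∀ {k} (i j : Fin (suc k)) → Dec (CycAdj (suc k) i j)
cycAdj? {k} i j =
  (suc (toℕ i) ℕ.% suc k ℕ.≟ toℕ j) ⊎-dec (suc (toℕ j) ℕ.% suc k ℕ.≟ toℕ i)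

-- Position j is a twin of i if every cycle-neighbour of i is one of j.
-- A vertex map that respects adjacency can only identify twins.
Twins : ∀ {k} → Fin (suc k) → Fin (suc k) → Set
Twins {k} i j = ∀ l → CycAdj (suc k) i l → CycAdj (suc k) j l

twins? : ∀ {k} (i j : Fin (suc k)) → Dec (Twins i j)
twins? i j = all? λ l → cycAdj? i l →-dec cycAdj? j l

-- The facts about C₃, C₄, C₅ below are finite checks, proved by evaluating
-- the corresponding decision procedures.
twin-free₃ : ∀ (i j : Fin 3) → Twins i j → i ≡ j
twin-free₃ = toWitness {a? = all? λ i → all? λ j → twins? i j →-dec i ≟ᶠ j} _

twins₄ : ∀ (i j : Fin 4) → Twins i j → i ≡ j ⊎ j ≡ next (next i)
twins₄ = toWitness
  {a? = all? λ i → all? λ j → twins? i j →-dec (i ≟ᶠ j ⊎-dec j ≟ᶠ next (next i))} _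

twin-free₅ : ∀ (i j : Fin 5) → Twins i j → i ≡ j
twin-free₅ = toWitness {a? = all? λ i → all? λ j → twins? i j →-dec i ≟ᶠ j} _

non-adjacent₃ : ∀ (i j : Fin 3) → ¬ CycAdj 3 i j → i ≡ j
non-adjacent₃ = toWitness {a? = all? λ i → all? λ j → ¬? (cycAdj? i j) →-dec i ≟ᶠ j} _

WithinTwo : ∀ {k} → Fin (suc k) → Fin (suc k) → Set
WithinTwo i j = i ≡ j ⊎ j ≡ next (next i) ⊎ i ≡ next (next j)

withinTwo? : ∀ {k} (i j : Fin (suc k)) → Dec (WithinTwo i j)
withinTwo? i j = i ≟ᶠ j ⊎-dec j ≟ᶠ next (next i) ⊎-dec i ≟ᶠ next (next j)

NonAdjacentWithinTwo : ℕ → Set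
NonAdjacentWithinTwo k = ∀ (i j : Fin (suc k)) → ¬ CycAdj (suc k) i j → WithinTwo i j

non-adjacent₄ : NonAdjacentWithinTwo 3
non-adjacent₄ = toWitness {a? = all? λ i → all? λ j → ¬? (cycAdj? i j) →-dec withinTwo? i j} _

non-adjacent₅ : NonAdjacentWithinTwo 4
non-adjacent₅ = toWitness {a? = all? λ i → all? λ j → ¬? (cycAdj? i j) →-dec withinTwo? i j} _

module _ {n : ℕ} (G : Graph n) where

  infix 4 _~_ _≁_
  _~_ _≁_ : Fin n → Fin n → Set
  u ~ v = Adj G u v
  u ≁ v = adj G u v ≡ false

  ~-sym : ∀ {u v} → u ~ v → v ~ u
  ~-sym {u} {v} p = trans (adj-sym G v u) p

  ≁-sym : ∀ {u v} → u ≁ v → v ≁ u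
  ≁-sym {u} {v} p = trans (adj-sym G v u) p

  ~≁-contra : ∀ {u v} → u ~ v → u ≁ v → ⊥
  ~≁-contra p q with trans (sym p) q
  ... | ()

  ~-or-≁ : ∀ u v → u ~ v ⊎ u ≁ v
  ~-or-≁ u v with adj G u v
  ... | true  = inj₁ refl
  ... | false = inj₂ refl

  ¬~⇒≁ : ∀ {u v} → ¬ u ~ v → u ≁ v
  ¬~⇒≁ ¬p = ¬-not ¬p

  ~⇒≢ : ∀ {u v} → u ~ v → u ≢ v
  ~⇒≢ {u} p refl = ~≁-contra p (irrefl G u)

  separated : ∀ {u v w} → u ≁ w → v ~ w → u ≢ v
  separated p q refl = ~≁-contra q p

  module CycleMap {k : ℕ} (f : Fin (suc k) → Fin n)
      (edge : ∀ i → f i ~ f (next i))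
      (chordless : ∀ i j → ¬ CycAdj (suc k) i j → f i ≁ f j) where

    preserves : ∀ i j → CycAdj (suc k) i j → f i ~ f j
    preserves i j c with adjacent⇒next c
    ... | inj₁ refl = edge i
    ... | inj₂ refl = ~-sym (edge j)

    reflects : ∀ i j → f i ~ f j → CycAdj (suc k) i j
    reflects i j fij with cycAdj? i j
    ... | yes c  = c
    ... | no ¬c = ⊥-elim (~≁-contra fij (chordless i j ¬c))

    identifies-twins : ∀ {i j} → f i ≡ f j → Twins i j
    identifies-twins {i} {j} fi≡fj l c =
      reflects j l (subst (_~ f l) fi≡fj (preserves i l c))

    induced : (∀ i j → Twins i j → i ≡ j ⊎ f i ≢ f j) → HasInducedCycle G (suc k)
    induced separate = f , injective , λ i j → reflects i j , preserves i j
      where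
      injective : ∀ {i j} → f i ≡ f j → i ≡ j
      injective {i} {j} fi≡fj with separate i j (identifies-twins fi≡fj)
      ... | inj₁ i≡j   = i≡j
      ... | inj₂ fi≢fj = ⊥-elim (fi≢fj fi≡fj)

  chordless-from-skips : ∀ {k} → NonAdjacentWithinTwo k → (f : Fin (suc k) → Fin n) →
    (∀ i → f i ≁ f (next (next i))) → ∀ i j → ¬ CycAdj (suc k) i j → f i ≁ f j
  chordless-from-skips close f skip i j ¬c with close i j ¬c
  ... | inj₁ refl        = irrefl G (f i)
  ... | inj₂ (inj₁ refl) = skip i
  ... | inj₂ (inj₂ refl) = ≁-sym (skip j)

  triangle : ∀ {u v w} → u ~ v → v ~ w → w ~ u → HasInducedCycle G 3
  triangle {u} {v} {w} uv vw wu =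
    CycleMap.induced f edge chordless λ i j t → inj₁ (twin-free₃ i j t)
    where
    f : Fin 3 → Fin n
    f = lookup (u ∷ v ∷ w ∷ [])
    edge : ∀ i → f i ~ f (next i)
    edge 0F = uv
    edge 1F = vw
    edge 2F = wu
    chordless : ∀ i j → ¬ CycAdj 3 i j → f i ≁ f j
    chordless i j ¬c with non-adjacent₃ i j ¬c
    ... | refl = irrefl G (f i)

  -- An induced C₄ needs its diagonals to be distinct as well as non-adjacent.
  square : ∀ {v₀ v₁ v₂ v₃} → v₀ ~ v₁ → v₁ ~ v₂ → v₂ ~ v₃ → v₃ ~ v₀ →
    v₀ ≁ v₂ → v₁ ≁ v₃ → v₀ ≢ v₂ → v₁ ≢ v₃ → HasInducedCycle G 4
  square {v₀} {v₁} {v₂} {v₃} e₀ e₁ e₂ e₃ n₀ n₁ d₀ d₁ =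
    CycleMap.induced f edge (chordless-from-skips non-adjacent₄ f skip) separate
    where
    f : Fin 4 → Fin n
    f = lookup (v₀ ∷ v₁ ∷ v₂ ∷ v₃ ∷ [])
    edge : ∀ i → f i ~ f (next i)
    edge 0F = e₀
    edge 1F = e₁
    edge 2F = e₂
    edge 3F = e₃
    skip : ∀ i → f i ≁ f (next (next i))
    skip 0F = n₀
    skip 1F = n₁
    skip 2F = ≁-sym n₀
    skip 3F = ≁-sym n₁
    diagonal : ∀ i → f i ≢ f (next (next i))
    diagonal 0F = d₀
    diagonal 1F = d₁
    diagonal 2F = ≢-sym d₀
    diagonal 3F = ≢-sym d₁
    separate : ∀ i j → Twins i j → i ≡ j ⊎ f i ≢ f j
    separate i j t with twins₄ i j t
    ... | inj₁ i≡j = inj₁ i≡j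
    ... | inj₂ refl = inj₂ (diagonal i)

  record Pentagon (v₀ v₁ v₂ v₃ v₄ : Fin n) : Set where
    field
      e₀ : v₀ ~ v₁
      e₁ : v₁ ~ v₂
      e₂ : v₂ ~ v₃
      e₃ : v₃ ~ v₄
      e₄ : v₄ ~ v₀
      n₀ : v₀ ≁ v₂
      n₁ : v₁ ≁ v₃
      n₂ : v₂ ≁ v₄
      n₃ : v₃ ≁ v₀
      n₄ : v₄ ≁ v₁

  pentagon : ∀ {v₀ v₁ v₂ v₃ v₄} → Pentagon v₀ v₁ v₂ v₃ v₄ → HasInducedCycle G 5
  pentagon {v₀} {v₁} {v₂} {v₃} {v₄} P =
    CycleMap.induced f edge (chordless-from-skips non-adjacent₅ f skip)
      λ i j t → inj₁ (twin-free₅ i j t)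
    where
    open Pentagon P
    f : Fin 5 → Fin n
    f = lookup (v₀ ∷ v₁ ∷ v₂ ∷ v₃ ∷ v₄ ∷ [])
    edge : ∀ i → f i ~ f (next i)
    edge 0F = e₀
    edge 1F = e₁
    edge 2F = e₂
    edge 3F = e₃
    edge 4F = e₄
    skip : ∀ i → f i ≁ f (next (next i))
    skip 0F = n₀
    skip 1F = n₁
    skip 2F = n₂
    skip 3F = n₃
    skip 4F = n₄

  MissesShortCycle : Set
  MissesShortCycle = Σ ℕ λ k → (k ≡ 3 ⊎ k ≡ 4 ⊎ k ≡ 5) × ¬ HasInducedCycle G k

  triangle-free : ¬ HasInducedCycle G 3 → ∀ {u v w} → u ~ v → v ~ w → w ≁ u
  triangle-free no-C₃ uv vw = ¬~⇒≁ λ wu → no-C₃ (triangle uv vw wu)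

  Win : Fin n → Fin n → Fin n → Set
  Win a b r = CopWin G (a ∷ b ∷ []) r

  Safe : Fin n → Fin n → Fin n → Set
  Safe a b r = r ≢ a × r ≢ b × a ≁ r × b ≁ r

  stay : ∀ {u} → Move G u u
  stay = inj₁ refl

  go : ∀ {u v} → u ~ v → Move G u v
  go = inj₂

  capture : ∀ {a b r} → a ~ r ⊎ b ~ r → Win a b r
  capture {a} {b} {r} (inj₁ ar) =
    win (r ∷ b ∷ []) (go ar ∷ stay ∷ []) (inj₁ (here refl))
  capture {a} {b} {r} (inj₂ br) =
    win (a ∷ r ∷ []) (stay ∷ go br ∷ []) (inj₁ (there (here refl)))

  -- After the robber's move he is caught, next to a cop, or safe; so the cops
  -- only have to deal with safe positions.
  respond : ∀ a b r → (Safe a b r → Win a b r) → r ∈ (a ∷ b ∷ []) ⊎ Win a b r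
  respond a b r continue with r ≟ᶠ a | r ≟ᶠ b | ~-or-≁ a r | ~-or-≁ b r
  ... | yes r≡a | _       | _       | _       = inj₁ (here r≡a)
  ... | no _    | yes r≡b | _       | _       = inj₁ (there (here r≡b))
  ... | no _    | no _    | inj₁ ar | _       = inj₂ (capture (inj₁ ar))
  ... | no _    | no _    | inj₂ _  | inj₁ br = inj₂ (capture (inj₂ br))
  ... | no r≢a  | no r≢b  | inj₂ a≁r | inj₂ b≁r =
    inj₂ (continue (r≢a , r≢b , a≁r , b≁r))

  round : ∀ {a b r} a′ b′ → Move G a a′ → Move G b b′ →
    (∀ r′ → Move G r r′ → Safe a′ b′ r′ → Win a′ b′ r′) → Win a b r
  round a′ b′ ma mb continue = win (a′ ∷ b′ ∷ []) (ma ∷ mb ∷ [])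
    (inj₂ λ r′ m → respond a′ b′ r′ (continue r′ m))

  swap : ∀ {a b r} → Win a b r → Win b a r
  swap (win (a′ ∷ b′ ∷ []) (ma ∷ mb ∷ []) outcome) =
    win (b′ ∷ a′ ∷ []) (mb ∷ ma ∷ []) (swap-outcome outcome)
    where
    swap-∈ : ∀ {x} → x ∈ (a′ ∷ b′ ∷ []) → x ∈ (b′ ∷ a′ ∷ [])
    swap-∈ (here p)         = there (here p)
    swap-∈ (there (here p)) = here p
    swap-outcome : ∀ {r} →
      r ∈ (a′ ∷ b′ ∷ []) ⊎ (∀ r′ → Move G r r′ → r′ ∈ (a′ ∷ b′ ∷ []) ⊎ Win a′ b′ r′) →
      r ∈ (b′ ∷ a′ ∷ []) ⊎ (∀ r′ → Move G r r′ → r′ ∈ (b′ ∷ a′ ∷ []) ⊎ Win b′ a′ r′)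
    swap-outcome (inj₁ caught) = inj₁ (swap-∈ caught)
    swap-outcome (inj₂ next-round) = inj₂ λ r′ m → swap-round (next-round r′ m)
      where
      swap-round : ∀ {r′} → r′ ∈ (a′ ∷ b′ ∷ []) ⊎ Win a′ b′ r′ →
        r′ ∈ (b′ ∷ a′ ∷ []) ⊎ Win b′ a′ r′
      swap-round (inj₁ caught) = inj₁ (swap-∈ caught)
      swap-round (inj₂ w)      = inj₂ (swap w)

  fled : ∀ {c r r′} → Move G r r′ → c ~ r → c ≁ r′ → r ~ r′
  fled (inj₁ refl) cr cr′ = ⊥-elim (~≁-contra cr cr′)
  fled (inj₂ rr′)  _  _   = rr′

  module _ (free : Free2K2 G) where

    no-2K2 : ∀ {a b c d} → a ~ b → c ~ d → a ≁ c → a ≁ d → b ≁ c → b ≁ d → ⊥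
    no-2K2 ab cd ac ad bc bd = free (_ , _ , _ , _ ,
      ~⇒≢ ab , separated ad cd , separated ac (~-sym cd) ,
      separated bd cd , separated bc (~-sym cd) , ~⇒≢ cd ,
      ab , cd , ac , ad , bc , bd)

    joined : ∀ {a b c d} → a ~ b → c ~ d → a ≁ c → b ≁ c → b ≁ d → a ~ d
    joined {a} {d = d} ab cd ac bc bd with ~-or-≁ a d
    ... | inj₁ ad = ad
    ... | inj₂ ad = ⊥-elim (no-2K2 ab cd ac ad bc bd)

    -- Pentagon position: robber on r₃, cops on r₁ and r, where y r r₁ r₂ r₃
    -- is an induced pentagon.
    escape : ∀ {y r r₁ r₂ r₃ s} → Pentagon y r r₁ r₂ r₃ →
      Move G r₃ s → Safe r₂ y s → r₃ ~ s × (r ~ s ⊎ r₁ ~ s)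
    escape {r = r} {r₁ = r₁} {r₃ = r₃} {s = s} P m (_ , _ , r₂≁s , _) =
      r₃s , next-to-r-or-r₁ (~-or-≁ r s)
      where
      open Pentagon P
      r₃s : r₃ ~ s
      r₃s = fled m e₃ r₂≁s
      next-to-r-or-r₁ : r ~ s ⊎ r ≁ s → r ~ s ⊎ r₁ ~ s
      next-to-r-or-r₁ (inj₁ rs)  = inj₁ rs
      next-to-r-or-r₁ (inj₂ r≁s) = inj₂ (joined (~-sym e₁) r₃s n₂ (≁-sym n₄) r≁s)

    cornered-near-r : ¬ HasInducedCycle G 3 → ∀ {y r r₁ r₂ r₃ s} →
      Pentagon y r r₁ r₂ r₃ → r₃ ~ s → r ~ s → r₂ ≁ s → Win r₂ y s
    cornered-near-r no-C₃ {y} {r} {r₁} {r₂} {r₃} {s} P r₃s rs r₂≁s =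
      round r₃ y (go e₃) stay λ t m (_ , _ , r₃≁t , y≁t) →
        ⊥-elim (no-safe-square t (fled m r₃s r₃≁t) (≁-sym r₃≁t) (≁-sym y≁t))
      where
      open Pentagon P
      no-safe-square : ∀ t → s ~ t → t ≁ r₃ → t ≁ y → ⊥
      no-safe-square t st t≁r₃ t≁y with ~-or-≁ t r₁ | ~-or-≁ t r₂
      ... | inj₁ tr₁ | _ = no-2K2 tr₁ (~-sym e₄) t≁y t≁r₃ (≁-sym n₀) n₂
      ... | inj₂ _ | inj₁ tr₂ =
        no-2K2 tr₂ e₀ t≁y (triangle-free no-C₃ rs st) n₃ (≁-sym n₁)
      ... | inj₂ t≁r₁ | inj₂ t≁r₂ =
        no-2K2 st e₂ (triangle-free no-C₃ (~-sym e₁) rs) (≁-sym r₂≁s) t≁r₁ t≁r₂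

    cornered-near-r₁ : ¬ HasInducedCycle G 3 → ∀ {y r r₁ r₂ r₃ s} →
      Pentagon y r r₁ r₂ r₃ → r₃ ~ s → r₁ ~ s → y ≁ s → Win r₂ y s
    cornered-near-r₁ no-C₃ {y} {r} {r₁} {r₂} {r₃} {s} P r₃s r₁s y≁s =
      round r₂ r₃ stay (go (~-sym e₄)) λ t m (_ , _ , r₂≁t , r₃≁t) →
        ⊥-elim (no-safe-square t (fled m r₃s r₃≁t) (≁-sym r₂≁t) (≁-sym r₃≁t))
      where
      open Pentagon P
      no-safe-square : ∀ t → s ~ t → t ≁ r₂ → t ≁ r₃ → ⊥
      no-safe-square t st t≁r₂ t≁r₃ with ~-or-≁ t y | ~-or-≁ t r
      ... | inj₁ ty | _ =
        no-2K2 ty e₂ (triangle-free no-C₃ r₁s st) t≁r₂ n₀ (≁-sym n₃)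
      ... | inj₂ _ | inj₁ tr = no-2K2 tr e₃ t≁r₂ t≁r₃ n₁ (≁-sym n₄)
      ... | inj₂ t≁y | inj₂ t≁r =
        no-2K2 st e₀ (≁-sym y≁s) (triangle-free no-C₃ e₁ r₁s) t≁y t≁r

    endgame : MissesShortCycle → ∀ {y r r₁ r₂ r₃} → Pentagon y r r₁ r₂ r₃ → Win r₁ r r₃
    endgame (_ , inj₂ (inj₂ refl) , no-C₅) P = ⊥-elim (no-C₅ (pentagon P))
    endgame (_ , inj₂ (inj₁ refl) , no-C₄) {y} {r} {r₁} {r₂} {r₃} P =
      round r₂ y (go e₂) (go (~-sym e₀)) λ s m safe → ⊥-elim (no-C₄ (square-at s m safe))
      where
      open Pentagon P
      square-at : ∀ s → Move G r₃ s → Safe r₂ y s → HasInducedCycle G 4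
      square-at s m safe@(s≢r₂ , s≢y , r₂≁s , y≁s) with escape P m safe
      ... | r₃s , inj₁ rs = square (~-sym rs) (~-sym e₀) (~-sym e₄) r₃s
        (≁-sym y≁s) (≁-sym n₄) s≢y (separated n₁ (~-sym e₃))
      ... | r₃s , inj₂ r₁s = square (~-sym r₁s) e₂ e₃ r₃s
        (≁-sym r₂≁s) n₂ s≢r₂ (separated (≁-sym n₀) e₄)
    endgame (_ , inj₁ refl , no-C₃) {y} {r} {r₁} {r₂} {r₃} P =
      round r₂ y (go e₂) (go (~-sym e₀)) corner
      where
      open Pentagon P
      corner : ∀ s → Move G r₃ s → Safe r₂ y s → Win r₂ y s
      corner s m safe@(_ , _ , r₂≁s , y≁s) with escape P m safe
      ... | r₃s , inj₁ rs  = cornered-near-r no-C₃ P r₃s rs r₂≁s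
      ... | r₃s , inj₂ r₁s = cornered-near-r₁ no-C₃ P r₃s r₁s y≁s

    module _ (missing : MissesShortCycle) where

      -- Cops on r and y, robber on r₂ at the end of an induced path y r r₁ r₂.
      -- The cops step to r₁ and r; the robber's next safe square r₃ is forced
      -- next to y, closing the pentagon.
      chase₃ : ∀ {y r r₁ r₂} → y ~ r → r ~ r₁ → r₁ ~ r₂ →
        y ≁ r₁ → y ≁ r₂ → r ≁ r₂ → Win r y r₂
      chase₃ {y} {r} {r₁} {r₂} yr rr₁ r₁r₂ y≁r₁ y≁r₂ r≁r₂ =
        round r₁ r (go rr₁) (go yr) close-pentagon
        where
        close-pentagon : ∀ r₃ → Move G r₂ r₃ → Safe r₁ r r₃ → Win r₁ r r₃
        close-pentagon r₃ m (_ , _ , r₁≁r₃ , r≁r₃) = endgame missing (record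
          { e₀ = yr ; e₁ = rr₁ ; e₂ = r₁r₂ ; e₃ = r₂r₃ ; e₄ = ~-sym y~r₃
          ; n₀ = y≁r₁ ; n₁ = r≁r₂ ; n₂ = r₁≁r₃ ; n₃ = ≁-sym y≁r₂ ; n₄ = ≁-sym r≁r₃ })
          where
          r₂r₃ : r₂ ~ r₃
          r₂r₃ = fled m r₁r₂ r₁≁r₃
          y~r₃ : y ~ r₃
          y~r₃ = joined yr r₂r₃ y≁r₂ r≁r₂ r≁r₃

      chase₂ : ∀ {a y r r₁} → a ~ y → y ~ r → r ~ r₁ → y ≁ r₁ → Win y a r₁
      chase₂ {a} {y} {r} ay yr rr₁ y≁r₁ =
        round r y (go yr) (go ay) λ r₂ m (_ , _ , r≁r₂ , y≁r₂) →
          chase₃ yr rr₁ (fled m rr₁ r≁r₂) y≁r₁ y≁r₂ r≁r₂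

      chase₁ : ∀ {a b r y} → a ~ b → r ~ y → a ~ y → Win a b r
      chase₁ {a} {y = y} ab ry ay =
        round y a (go ay) (go (~-sym ab)) λ r₁ m (_ , _ , y≁r₁ , _) →
          chase₂ ay (~-sym ry) (fled m (~-sym ry) y≁r₁) y≁r₁

      module _ (conn : Connected G) where

        -- Cops on an edge ab, robber safe at r.  By connectivity r has a
        -- neighbour y, and 2K₂-freeness puts a or b next to y.
        opening : ∀ {a b r} → a ~ b → Safe a b r → Win a b r
        opening {a} {b} {r} ab (r≢a , _ , a≁r , b≁r) with conn r a
        ... | here = ⊥-elim (r≢a refl)
        ... | step {w = y} ry _ with ~-or-≁ a y | ~-or-≁ b y
        ...   | inj₁ ay | _ = chase₁ ab ry ay
        ...   | inj₂ _ | inj₁ by = swap (chase₁ (~-sym ab) ry by)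
        ...   | inj₂ a≁y | inj₂ b≁y = ⊥-elim (no-2K2 ab ry a≁r a≁y b≁r b≁y)

        -- Starting from any vertex v: the cops start on an edge at v, or, if v
        -- is isolated, G is the single vertex v.
        two-cops-win : Fin n → CopsWin G 2
        two-cops-win v with any? (λ w → adj G v w Bool.≟ true)
        ... | yes (w , vw) = (v ∷ w ∷ []) , λ r → respond v w r (opening vw)
        ... | no isolated  = (v ∷ v ∷ []) , λ r → inj₁ (here (only-vertex r))
          where
          only-vertex : ∀ r → r ≡ v
          only-vertex r with conn v r
          ... | here       = refl
          ... | step vw _ = ⊥-elim (isolated (_ , vw))

-- The empty graph needs no cops; otherwise the cops start from vertex 0.
theorem2 : ∀ {n : ℕ} (G : Graph n) → Connected G → Free2K2 G →
    Σ ℕ (λ k → (k ≡ 3 ⊎ k ≡ 4 ⊎ k ≡ 5) × ¬ HasInducedCycle G k) →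
    CopNumber≤ G 2
theorem2 {zero}  G _    _    _       = 0 , z≤n , [] , λ ()
theorem2 {suc _} G conn free missing =
  2 , ≤-refl , two-cops-win G free missing conn zero
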